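{- Let $a\ge 2$, $m\ge 2$, $b\ge 0$, $s\ge 1$ be integers and let $n$ be a positive integer. Suppose $p_1<p_2<\dots<p_m$ are $m$ distinct primes each of which is an entry of the tuple $$D_{\{a,b,s\}}(n)=(a^{b+1}n+1,\,a^{b+2}n+1,\,\dots,\,a^{b+s}n+1),$$ and let $N=p_1p_2\cdots p_m$. Then $N$ is not a Carmichael number.
   Context: A Carmichael number is a composite integer $N$ such that $a^N\equiv a \pmod N$ for every integer $a$. -}

module Defs where

open import Data.Nat using (ℕ; _*_; _+_; _^_; _<_)
open import Data.Nat.Primality using (Composite)
open import Data.Fin using (Fin; toℕ)
open import Data.Product using (_×_)
import Data.Integer as ℤ
open import Data.Integer.Divisibility using (_∣_)

Carmichael : ℕ → Set
Carmichael N = Composite N × ((a : ℤ.ℤ) → ℤ.+ N ∣ ((a ℤ.^ N) ℤ.- a))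

prodFin : (m : ℕ) → (Fin m → ℕ) → ℕ
prodFin ℕ.zero    p = 1
prodFin (ℕ.suc m) p = p Fin.zero * prodFin m (λ i → p (Fin.suc i))
  where import Data.Fin as Fin

-- The argument rests on the necessary half of Korselt's criterion: if a prime q
-- divides a number N with x^N ≡ x (mod N) for all x, then q - 1 divides N - 1.
-- The module KorseltCriterion proves this over ℤ without primitive roots:
-- Fermat's little theorem (via the freshman's dream and the binomial theorem)
-- shows that every unit c modulo q satisfies c^r ≡ 1, where r is the remainder
-- of N - 1 modulo q - 1; a root bound for polynomial functions (Lagrange's
-- theorem, phrased through the factor theorem) then forces r = 0.
--
-- The theorem itself is elementary arithmetic on top of Korselt: writing the
-- smallest prime as A + 1 with A = a^e n, every larger prime is ≡ 1 (mod A·a),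
-- so N - 1 ≡ A (mod A·a); but Korselt at the second prime gives A·a ∣ N - 1,
-- whence a ∣ 1.  The ℕ-level lemmas for this step follow the module.
module Submission where

module KorseltCriterion where

  open import Data.Nat as ℕ using (ℕ; zero; suc; z≤n; s≤s; _∸_; _!)
  import Data.Nat.Properties as ℕP
  import Data.Nat.Divisibility as ℕD
  open import Data.Nat.DivMod using (_%_; _/_; m≡m%n+[m/n]*n; m%n<n; m*[n/m]≡n)
  open import Data.Nat.Primality using (Prime; euclidsLemma; prime⇒nonTrivial)
  open import Data.Nat.Combinatorics using (_C_; nCn≡1; k![n∸k]!∣n!)
  open import Data.Nat.Combinatorics.Specification using (nCk≡n!/k![n-k]!)
  open import Data.Integer as ℤ using (ℤ; +_; _+_; _*_; _-_; -_; _^_)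
  import Data.Integer.Properties as ℤP
  import Data.Integer.Divisibility as Unsigned
  open import Data.Integer.Divisibility.Signed
  open import Data.Integer.Tactic.RingSolver using (solve-∀)
  open import Data.Fin as Fin using (Fin; toℕ; fromℕ; inject₁)
  import Data.Fin.Properties as FinP
  open import Data.Vec.Functional using (init; tail)
  open import Function using (_∘_)
  import Algebra.Properties.CommutativeSemiring.Binomial as Binomial
  import Algebra.Properties.Monoid.Sum as Sum
  import Algebra.Properties.Semiring.Exp as Exp
  import Algebra.Properties.Monoid.Mult as Mult
  open import Data.Product using (∃-syntax; _×_; _,_)
  open import Data.Sum using (_⊎_; inj₁; inj₂)
  open import Data.Empty using (⊥-elim)
  open import Relation.Nullary using (¬_)
  open import Relation.Binary.PropositionalEquality

  euclidℤ : ∀ {q} → Prime q → ∀ x y → + q ∣ x * y → + q ∣ x ⊎ + q ∣ y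
  euclidℤ {q} q-prime x y q∣xy
    with euclidsLemma ℤ.∣ x ∣ ℤ.∣ y ∣ q-prime (subst (q ℕD.∣_) (ℤP.abs-* x y) (∣⇒∣ᵤ q∣xy))
  ... | inj₁ q∣x = inj₁ (∣ᵤ⇒∣ q∣x)
  ... | inj₂ q∣y = inj₂ (∣ᵤ⇒∣ q∣y)

  cancel-∣ : ∀ {q} → Prime q → ∀ x y → ¬ (+ q ∣ x) → + q ∣ x * y → + q ∣ y
  cancel-∣ q-prime x y q∤x q∣xy with euclidℤ q-prime x y q∣xy
  ... | inj₁ q∣x = ⊥-elim (q∤x q∣x)
  ... | inj₂ q∣y = q∣y

  ∤-small : ∀ {q} c → 0 ℕ.< c → c ℕ.< q → ¬ (+ q ∣ + c)
  ∤-small c 0<c c<q q∣c = ℕP.<⇒≱ c<q (ℕD.∣⇒≤ ⦃ ℕ.>-nonZero 0<c ⦄ (∣⇒∣ᵤ q∣c))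

  prime∤! : ∀ {q} → Prime q → ∀ j → j ℕ.< q → ¬ (q ℕD.∣ j !)
  prime∤! q-prime zero _ q∣1 = ℕ.nonTrivial⇒≢1 ⦃ prime⇒nonTrivial q-prime ⦄ (ℕD.∣1⇒≡1 q∣1)
  prime∤! q-prime (suc j) j<q q∣j! with euclidsLemma (suc j) (j !) q-prime q∣j!
  ... | inj₁ q∣1+j = ℕP.<⇒≱ j<q (ℕD.∣⇒≤ q∣1+j)
  ... | inj₂ q∣j!  = prime∤! q-prime j (ℕP.<-trans (ℕP.n<1+n j) j<q) q∣j!

  factorials*C≡! : ∀ {n k} → k ℕ.≤ n → (k ! ℕ.* (n ∸ k) !) ℕ.* (n C k) ≡ n !
  factorials*C≡! {n} {k} k≤n = begin
    (k ! ℕ.* (n ∸ k) !) ℕ.* (n C k)                    ≡⟨ cong ((k ! ℕ.* (n ∸ k) !) ℕ.*_) (nCk≡n!/k![n-k]! k≤n) ⟩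
    (k ! ℕ.* (n ∸ k) !) ℕ.* (n ! / (k ! ℕ.* (n ∸ k) !)) ≡⟨ m*[n/m]≡n (k![n∸k]!∣n! k≤n) ⟩
    n !                                                ∎
    where
    open ≡-Reasoning
    instance
      k![n-k]!≢0 : ℕ.NonZero (k ! ℕ.* (n ∸ k) !)
      k![n-k]!≢0 = ℕP._!*_!≢0 k (n ∸ k)

  -- The inner binomial coefficients of a prime q are divisible by q,
  -- since q divides k! (q-k)! (q C k) = q! but neither k! nor (q-k)!.
  prime∣C : ∀ {q} → Prime q → ∀ k → 0 ℕ.< k → k ℕ.< q → q ℕD.∣ (q C k)
  prime∣C {q@(suc q-1)} q-prime k 0<k k<q
    with euclidsLemma (k ! ℕ.* (q ∸ k) !) (q C k) q-prime
           (subst (q ℕD.∣_) (sym (factorials*C≡! (ℕP.<⇒≤ k<q))) (ℕD.m∣m*n (q-1 !)))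
  ... | inj₂ q∣qCk = q∣qCk
  ... | inj₁ q∣k![q-k]! with euclidsLemma (k !) ((q ∸ k) !) q-prime q∣k![q-k]!
  ...   | inj₁ q∣k!     = ⊥-elim (prime∤! q-prime k k<q q∣k!)
  ...   | inj₂ q∣[q-k]! = ⊥-elim (prime∤! q-prime (q ∸ k) (ℕP.∸-monoʳ-< 0<k (ℕP.<⇒≤ k<q)) q∣[q-k]!)

  private
    module ℤBinomial = Binomial ℤP.+-*-commutativeSemiring
    module ℤSum      = Sum ℤP.+-0-monoid
    module ℤMult     = Mult ℤP.+-0-monoid
    module ℤExp      = Exp ℤP.+-*-semiring

  ^-agrees : ∀ x n → x ℤExp.^ n ≡ x ^ n
  ^-agrees x zero    = refl
  ^-agrees x (suc n) = cong (x *_) (^-agrees x n)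

  ×-agrees : ∀ n v → n ℤMult.× v ≡ + n * v
  ×-agrees zero    v = sym (ℤP.*-zeroˡ v)
  ×-agrees (suc n) v = trans (cong (λ w → v + w) (×-agrees n v)) (sym (ℤP.suc-* (+ n) v))

  binomialTerm-x+1 : ∀ x q (k : Fin (suc q)) →
    ℤBinomial.binomialTerm x (+ 1) q k ≡ + (q C toℕ k) * x ^ toℕ k
  binomialTerm-x+1 x q k = begin
    (q C j) ℤMult.× (x ℤExp.^ j * (+ 1) ℤExp.^ (q ∸ j))
      ≡⟨ ×-agrees (q C j) _ ⟩
    + (q C j) * (x ℤExp.^ j * (+ 1) ℤExp.^ (q ∸ j))
      ≡⟨ cong₂ (λ u v → + (q C j) * (u * v)) (^-agrees x j) (trans (^-agrees (+ 1) (q ∸ j)) (ℤP.^-zeroˡ (q ∸ j))) ⟩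
    + (q C j) * (x ^ j * + 1)
      ≡⟨ cong (+ (q C j) *_) (ℤP.*-identityʳ (x ^ j)) ⟩
    + (q C j) * x ^ j ∎
    where
    open ≡-Reasoning
    j : ℕ
    j = toℕ k

  ∣-sum : ∀ d {n} (v : Fin n → ℤ) → (∀ i → d ∣ v i) → d ∣ ℤSum.sum v
  ∣-sum d {zero}  v d∣v = divides (+ 0) (sym (ℤP.*-zeroˡ d))
  ∣-sum d {suc n} v d∣v = ∣m∣n⇒∣m+n (d∣v Fin.zero) (∣-sum d (tail v) (d∣v ∘ Fin.suc))

  -- Freshman's dream: (x + 1)^q ≡ x^q + 1 (mod q) for a prime q, because
  -- every binomial term other than the first and the last is divisible by q.
  freshman's-dream : ∀ {q} → Prime q → ∀ x → + q ∣ (x + + 1) ^ q - (x ^ q + + 1)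
  freshman's-dream {q@(suc _)} q-prime x = subst (+ q ∣_) middle≡ q∣middle
    where
    open ≡-Reasoning
    term : Fin (suc q) → ℤ
    term = ℤBinomial.binomialTerm x (+ 1) q
    middle : ℤ
    middle = ℤSum.sum (init (tail term))

    q∣middle : + q ∣ middle
    q∣middle = ∣-sum (+ q) (init (tail term)) λ i →
      let k = toℕ (inject₁ i) in
      subst (+ q ∣_) (sym (binomialTerm-x+1 x q (Fin.suc (inject₁ i))))
        (∣m⇒∣m*n {m = + (q C suc k)} (x ^ suc k) (∣ᵤ⇒∣ (prime∣C q-prime (suc k) (s≤s z≤n) (s≤s (FinP.inject₁ℕ< i)))))

    lastTerm : term (fromℕ q) ≡ x ^ q
    lastTerm = begin
      term (fromℕ q)                                   ≡⟨ binomialTerm-x+1 x q (fromℕ q) ⟩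
      + (q C toℕ (fromℕ q)) * x ^ toℕ (fromℕ q)         ≡⟨ cong (λ j → + (q C j) * x ^ j) (FinP.toℕ-fromℕ q) ⟩
      + (q C q) * x ^ q                                ≡⟨ cong (λ c → + c * x ^ q) (nCn≡1 q) ⟩
      + 1 * x ^ q                                      ≡⟨ ℤP.*-identityˡ (x ^ q) ⟩
      x ^ q                                            ∎

    expansion : (x + + 1) ^ q ≡ + 1 + (middle + x ^ q)
    expansion = begin
      (x + + 1) ^ q                               ≡⟨ sym (^-agrees (x + + 1) q) ⟩
      (x + + 1) ℤExp.^ q                          ≡⟨ ℤBinomial.theorem q x (+ 1) ⟩
      term Fin.zero + ℤSum.sum (tail term)        ≡⟨ cong₂ _+_ (binomialTerm-x+1 x q Fin.zero) (ℤSum.sum-init-last (tail term)) ⟩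
      + 1 + (middle + term (fromℕ q))             ≡⟨ cong (λ y → + 1 + (middle + y)) lastTerm ⟩
      + 1 + (middle + x ^ q)                      ∎

    rearrange : ∀ a m b → (a + (m + b)) - (b + a) ≡ m
    rearrange = solve-∀

    middle≡ : middle ≡ (x + + 1) ^ q - (x ^ q + + 1)
    middle≡ = sym (trans (cong (_- (x ^ q + + 1)) expansion) (rearrange (+ 1) middle (x ^ q)))

  -- Fermat's little theorem: c^q ≡ c (mod q), by induction on c using the freshman's dream.
  fermat : ∀ {q} → Prime q → ∀ c → + q ∣ (+ c) ^ q - + c
  fermat {q@(suc q-1)} q-prime zero = subst (+ q ∣_) (sym (ℤP.*-zeroˡ ((+ 0) ^ q-1))) (divides (+ 0) refl)
  fermat {q} q-prime (suc c) =
    subst (λ y → + q ∣ y ^ q - y) (ℤP.+-comm (+ c) (+ 1))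
      (subst (+ q ∣_) (telescope ((+ c + + 1) ^ q) ((+ c) ^ q) (+ c))
        (∣m∣n⇒∣m+n (freshman's-dream q-prime (+ c)) (fermat q-prime c)))
    where
    telescope : ∀ A B y → A - (B + + 1) + (B - y) ≡ A - (y + + 1)
    telescope = solve-∀

  incongruent : ∀ {q} b c → b ℕ.< c → c ℕ.< q → ¬ (+ q ∣ + b - + c)
  incongruent {q} b c b<c c<q q∣b-c = ∤-small (c ∸ b) (ℕP.m<n⇒0<n∸m b<c)
    (ℕP.≤-<-trans (ℕP.m∸n≤m c b) c<q) q∣c-b
    where
    b-c≡-[c-b] : + b - + c ≡ - + (c ∸ b)
    b-c≡-[c-b] = trans (ℤP.m-n≡m⊖n b c) (ℤP.⊖-< b<c)
    q∣c-b : + q ∣ + (c ∸ b)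
    q∣c-b = subst (+ q ∣_) (ℤP.neg-involutive (+ (c ∸ b)))
              (∣m⇒∣-m (subst (+ q ∣_) b-c≡-[c-b] q∣b-c))

  -- PolyFun d ℓ f: the function f is a polynomial of degree at most d whose
  -- coefficient of x^d is ℓ.
  PolyFun : ℕ → ℤ → (ℤ → ℤ) → Set
  PolyFun zero    ℓ f = ∀ x → f x ≡ ℓ
  PolyFun (suc d) ℓ f = ∀ r → ∃[ g ] PolyFun d ℓ g × (∀ x → f x - f r ≡ (x - r) * g x)

  add-lower : ∀ d {ℓ ℓ′ f h} → PolyFun (suc d) ℓ f → PolyFun d ℓ′ h →
              ∀ y → PolyFun (suc d) ℓ (λ x → f x + y * h x)
  add-lower zero {ℓ′ = ℓ′} {f} {h} F H y r with F r
  ... | g , G , f-factors = g , G , λ x → begin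
    f x + y * h x - (f r + y * h r)  ≡⟨ cong₂ (λ u v → f x + y * u - (f r + y * v)) (H x) (H r) ⟩
    f x + y * ℓ′ - (f r + y * ℓ′)    ≡⟨ cancel-constant (f x) (f r) (y * ℓ′) ⟩
    f x - f r                        ≡⟨ f-factors x ⟩
    (x - r) * g x                    ∎
    where
    open ≡-Reasoning
    cancel-constant : ∀ u v c → u + c - (v + c) ≡ u - v
    cancel-constant = solve-∀
  add-lower (suc d) {f = f} {h} F H y r with F r | H r
  ... | g , G , f-factors | k , K , h-factors = (λ x → g x + y * k x) , add-lower d {f = g} G K y , λ x → begin
    f x + y * h x - (f r + y * h r)      ≡⟨ split (f x) (f r) (h x) (h r) y ⟩
    (f x - f r) + y * (h x - h r)        ≡⟨ cong₂ (λ u v → u + y * v) (f-factors x) (h-factors x) ⟩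
    (x - r) * g x + y * ((x - r) * k x)  ≡⟨ collect (x - r) (g x) (k x) y ⟩
    (x - r) * (g x + y * k x)            ∎
    where
    open ≡-Reasoning
    split : ∀ a b c e y → a + y * c - (b + y * e) ≡ (a - b) + y * (c - e)
    split = solve-∀
    collect : ∀ z a b y → z * a + y * (z * b) ≡ z * (a + y * b)
    collect = solve-∀

  mul-x : ∀ d {ℓ f} → PolyFun d ℓ f → PolyFun (suc d) ℓ (λ x → x * f x)
  mul-x zero {ℓ} {f} F r = (λ _ → ℓ) , (λ _ → refl) , λ x → begin
    x * f x - r * f r  ≡⟨ cong₂ (λ u v → x * u - r * v) (F x) (F r) ⟩
    x * ℓ - r * ℓ      ≡⟨ factor x r ℓ ⟩
    (x - r) * ℓ        ∎
    where
    open ≡-Reasoning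
    factor : ∀ x r c → x * c - r * c ≡ (x - r) * c
    factor = solve-∀
  mul-x (suc d) {f = f} F r with F r
  ... | h , H , f-factors = (λ x → f x + r * h x) , add-lower d {f = f} F H r , λ x → begin
    x * f x - r * f r                  ≡⟨ split x r (f x) (f r) ⟩
    (x - r) * f x + r * (f x - f r)    ≡⟨ cong (λ u → (x - r) * f x + r * u) (f-factors x) ⟩
    (x - r) * f x + r * ((x - r) * h x) ≡⟨ collect x r (f x) (h x) ⟩
    (x - r) * (f x + r * h x)          ∎
    where
    open ≡-Reasoning
    split : ∀ x r a b → x * a - r * b ≡ (x - r) * a + r * (a - b)
    split = solve-∀
    collect : ∀ x r a b → (x - r) * a + r * ((x - r) * b) ≡ (x - r) * (a + r * b)
    collect = solve-∀

  sub-constant : ∀ d {ℓ f} → PolyFun (suc d) ℓ f → ∀ c → PolyFun (suc d) ℓ (λ x → f x - c)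
  sub-constant d {f = f} F c r with F r
  ... | g , G , f-factors = g , G , λ x → trans (cancel (f x) (f r) c) (f-factors x)
    where
    cancel : ∀ u v c → u - c - (v - c) ≡ u - v
    cancel = solve-∀

  monomial : ∀ d → PolyFun d (+ 1) (_^ d)
  monomial zero    _ = refl
  monomial (suc d)   = mul-x d (monomial d)

  -- Each root r splits
  -- off a factor x - r, which is a unit at the remaining roots.
  root-bound : ∀ {q} → Prime q → ∀ d {ℓ f} → PolyFun d ℓ f → ¬ (+ q ∣ ℓ) →
               ∀ k → k ℕ.< q → (∀ c → 0 ℕ.< c → c ℕ.≤ k → + q ∣ f (+ c)) → k ℕ.≤ d
  root-bound _ _ _ _ zero _ _ = z≤n
  root-bound {q} _ zero F q∤ℓ (suc k) _ roots =
    ⊥-elim (q∤ℓ (subst (+ q ∣_) (F (+ 1)) (roots 1 (s≤s z≤n) (s≤s z≤n))))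
  root-bound {q} q-prime (suc d) {f = f} F q∤ℓ (suc k) 1+k<q roots with F (+ suc k)
  ... | g , G , f-factors = s≤s (root-bound q-prime d G q∤ℓ k k<q roots-of-g)
    where
    k<q : k ℕ.< q
    k<q = ℕP.<-trans (ℕP.n<1+n k) 1+k<q
    roots-of-g : ∀ c → 0 ℕ.< c → c ℕ.≤ k → + q ∣ g (+ c)
    roots-of-g c 0<c c≤k =
      cancel-∣ q-prime (+ c - + suc k) (g (+ c)) (incongruent c (suc k) (s≤s c≤k) 1+k<q)
        (subst (+ q ∣_) (f-factors (+ c))
          (∣m∣n⇒∣m-n (roots c 0<c (ℕP.m≤n⇒m≤1+n c≤k)) (roots (suc k) (s≤s z≤n) ℕP.≤-refl)))

  CarmichaelCongruence : ℕ → Set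
  CarmichaelCongruence N = ∀ x → + N Unsigned.∣ x ^ N - x

  fermat-unit : ∀ {Q} → Prime (suc Q) → ∀ c → 0 ℕ.< c → c ℕ.≤ Q → + suc Q ∣ (+ c) ^ Q - + 1
  fermat-unit {Q} q-prime c 0<c c≤Q =
    cancel-∣ q-prime (+ c) ((+ c) ^ Q - + 1) (∤-small c 0<c (s≤s c≤Q))
      (subst (+ suc Q ∣_) (factor (+ c) ((+ c) ^ Q)) (fermat q-prime c))
    where
    factor : ∀ x y → x * y - x ≡ x * (y - + 1)
    factor = solve-∀

  power-of-one : ∀ {q} y t → + q ∣ y - + 1 → + q ∣ y ^ t - + 1
  power-of-one {q} y zero    _      = divides (+ 0) (sym (ℤP.*-zeroˡ (+ q)))
  power-of-one {q} y (suc t) q∣y-1 =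
    subst (+ q ∣_) (sym (split y (y ^ t)))
      (∣m∣n⇒∣m+n (∣n⇒∣m*n y (power-of-one y t q∣y-1)) q∣y-1)
    where
    split : ∀ y z → y * z - + 1 ≡ y * (z - + 1) + (y - + 1)
    split = solve-∀

  -- If N satisfies the Carmichael congruence, q divides N and
  -- N = 1 + r + t (q - 1), then every unit c modulo q satisfies c^r ≡ 1:
  -- cancel c from c^N ≡ c and use c^(q-1) ≡ 1.
  unit-power : ∀ {Q N} → Prime (suc Q) → CarmichaelCongruence N → suc Q ℕD.∣ N →
               ∀ r t → N ≡ suc (r ℕ.+ t ℕ.* Q) →
               ∀ c → 0 ℕ.< c → c ℕ.≤ Q → + suc Q ∣ (+ c) ^ r - + 1
  unit-power {Q} {N} q-prime carmichael q∣N r t N≡ c 0<c c≤Q =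
    ∣m+n∣m⇒∣n (subst (+ q ∣_) (split (x ^ r) z) q∣x^r*z-1) (∣n⇒∣m*n (x ^ r) q∣z-1)
    where
    q : ℕ
    q = suc Q
    x z : ℤ
    x = + c
    z = x ^ (t ℕ.* Q)

    q∣z-1 : + q ∣ z - + 1
    q∣z-1 = subst (λ w → + q ∣ w - + 1)
      (trans (ℤP.^-*-assoc x Q t) (cong (x ^_) (ℕP.*-comm Q t)))
      (power-of-one (x ^ Q) t (fermat-unit q-prime c 0<c c≤Q))

    x^N≡ : x ^ N - x ≡ x * (x ^ r * z - + 1)
    x^N≡ = begin
      x ^ N - x                     ≡⟨ cong (λ n → x ^ n - x) N≡ ⟩
      x * x ^ (r ℕ.+ t ℕ.* Q) - x   ≡⟨ cong (λ w → x * w - x) (ℤP.^-distribˡ-+-* x r (t ℕ.* Q)) ⟩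
      x * (x ^ r * z) - x           ≡⟨ factor x (x ^ r * z) ⟩
      x * (x ^ r * z - + 1)         ∎
      where
      open ≡-Reasoning
      factor : ∀ x y → x * y - x ≡ x * (y - + 1)
      factor = solve-∀

    q∣x^r*z-1 : + q ∣ x ^ r * z - + 1
    q∣x^r*z-1 = cancel-∣ q-prime x _ (∤-small c 0<c (s≤s c≤Q))
      (subst (+ q ∣_) x^N≡ (∣-trans {j = + N} (∣ᵤ⇒∣ q∣N) (∣ᵤ⇒∣ (carmichael x))))

    split : ∀ y z → y * z - + 1 ≡ y * (z - + 1) + (y - + 1)
    split = solve-∀

  -- Korselt's criterion, necessary direction: if N satisfies the Carmichael
  -- congruence and the prime q divides N, then q - 1 divides N - 1.  Otherwise
  -- N - 1 ≡ r (mod q - 1) with 0 < r < q - 1, and the polynomial x^r - 1 would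
  -- have the q - 1 roots 1, …, q - 1 modulo q, contradicting the root bound.
  korselt : ∀ {Q N} → Prime (suc Q) → CarmichaelCongruence N → suc Q ℕD.∣ N →
            Q ℕD.∣ ℕ.pred N
  korselt {Q} {zero} _ _ _ = ℕD.divides 0 refl
  korselt {zero} {suc D} () _ _
  korselt {Q@(suc _)} {suc D} q-prime carmichael q∣N with D % Q in D%Q≡r
  ... | zero   = ℕD.m%n≡0⇒n∣m D Q D%Q≡r
  ... | suc r′ = ⊥-elim (ℕP.<⇒≱ r<Q Q≤r)
    where
    r : ℕ
    r = suc r′
    r<Q : r ℕ.< Q
    r<Q = subst (ℕ._< Q) D%Q≡r (m%n<n D Q)
    N≡ : suc D ≡ suc (r ℕ.+ (D / Q) ℕ.* Q)
    N≡ = cong suc (trans (m≡m%n+[m/n]*n D Q) (cong (ℕ._+ (D / Q) ℕ.* Q) D%Q≡r))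
    Q≤r : Q ℕ.≤ r
    Q≤r = root-bound q-prime r {f = λ x → x ^ r - + 1} (sub-constant r′ {f = _^ r} (monomial r) (+ 1))
            (∤-small 1 (s≤s z≤n) (s≤s (s≤s z≤n))) Q ℕP.≤-refl
            (unit-power q-prime carmichael q∣N r (D / Q) N≡)

open KorseltCriterion using (korselt)

open import Defs
open import Data.Nat using (ℕ; _+_; _*_; _^_; _≤_; _<_)
open import Data.Nat.Primality using (Prime)
open import Data.Fin using (Fin; toℕ)
open import Data.Product using (_×_; ∃-syntax)
open import Relation.Nullary using (¬_)
open import Relation.Binary.PropositionalEquality using (_≡_)

open import Data.Nat using (zero; suc; z≤n; s≤s; pred; NonZero; >-nonZero)
import Data.Nat.Properties as ℕP
open import Data.Nat.Divisibility using (_∣_; ∣-trans; m∣m*n; n∣m*n; ∣m+n∣m⇒∣n; *-cancelˡ-∣; ∣1⇒≡1)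
open import Data.Nat.Tactic.RingSolver using (solve-∀)
open import Data.Fin using () renaming (zero to 0F; suc to 1+)
open import Data.Product using (_,_; proj₁; proj₂)
open import Relation.Binary.PropositionalEquality using (refl; sym; trans; cong; cong₂; subst; subst₂)

factor∣prodFin : ∀ m (p : Fin m → ℕ) i → p i ∣ prodFin m p
factor∣prodFin (suc m) p 0F     = m∣m*n (prodFin m (λ i → p (1+ i)))
factor∣prodFin (suc m) p (1+ i) = ∣-trans (factor∣prodFin m (λ j → p (1+ j)) i) (n∣m*n (p 0F))

_≡1[mod_] : ℕ → ℕ → Set
x ≡1[mod d ] = ∃[ u ] x ≡ 1 + d * u

prodFin-≡1 : ∀ m (p : Fin m → ℕ) d → (∀ i → p i ≡1[mod d ]) → prodFin m p ≡1[mod d ]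
prodFin-≡1 zero    p d _    = 0 , cong suc (sym (ℕP.*-zeroʳ d))
prodFin-≡1 (suc m) p d p≡1 with p≡1 0F | prodFin-≡1 m (λ i → p (1+ i)) d (λ i → p≡1 (1+ i))
... | u , p₀≡ | t , rest≡ = u + t + d * u * t , trans (cong₂ _*_ p₀≡ rest≡) (expand d u t)
  where
  expand : ∀ d u t → (1 + d * u) * (1 + d * t) ≡ 1 + d * (u + t + d * u * t)
  expand = solve-∀

exponent-mono : ∀ {a n e e′} → 1 ≤ a → a ^ e * n + 1 < a ^ e′ * n + 1 → e < e′
exponent-mono {a} {n} {e} {e′} 1≤a lt = ℕP.≰⇒> λ e′≤e →
  ℕP.<⇒≱ lt (ℕP.+-monoˡ-≤ 1 (ℕP.*-monoˡ-≤ n (ℕP.^-monoʳ-≤ a ⦃ >-nonZero 1≤a ⦄ e′≤e)))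

≡1-mod-higher : ∀ a n {e e′} → e < e′ → (a ^ e′ * n + 1) ≡1[mod a ^ e * n * a ]
≡1-mod-higher a n {e} e<e′ with ℕP.m≤n⇒∃[o]m+o≡n e<e′
... | j , refl = a ^ j , trans (ℕP.+-comm _ 1)
      (cong suc (trans (cong (_* n) (ℕP.^-distribˡ-+-* a (suc e) j)) (regroup a (a ^ e) (a ^ j) n)))
  where
  regroup : ∀ a x y n → a * x * y * n ≡ x * n * a * y
  regroup = solve-∀

-- The final contradiction: for a ≥ 2 and A ≠ 0, the number A·a does not divide
-- (A + 1)(1 + A·a·t) - 1 = A·a·t·(A + 1) + A, as it would then divide A.
no-divisor : ∀ {a A} t → 2 ≤ a → NonZero A → ¬ (A * a ∣ pred ((A + 1) * (1 + A * a * t)))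
no-divisor {a} {A} t 2≤a A≢0 Aa∣N-1 = ℕP.<⇒≢ 2≤a (sym (∣1⇒≡1 a∣1))
  where
  expand : ∀ A a t → pred ((A + 1) * (1 + A * a * t)) ≡ A * a * (t * (A + 1)) + A
  expand A a t = cong pred (regroup A a t)
    where
    regroup : ∀ A a t → (A + 1) * (1 + A * a * t) ≡ 1 + (A * a * (t * (A + 1)) + A)
    regroup = solve-∀
  Aa∣A : A * a ∣ A * 1
  Aa∣A = subst (A * a ∣_) (sym (ℕP.*-identityʳ A))
    (∣m+n∣m⇒∣n (subst (A * a ∣_) (expand A a t) Aa∣N-1) (m∣m*n (t * (A + 1))))
  a∣1 : a ∣ 1
  a∣1 = *-cancelˡ-∣ A ⦃ A≢0 ⦄ Aa∣A

-- Write p i = a^(e i) n + 1 and A = a^(e 0) n, so that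
-- p 0 = A + 1.  Since the primes increase, e 0 < e i for i > 0, hence every
-- later prime is ≡ 1 (mod A·a) and N = (A + 1)(1 + A·a·t) for some t.  Korselt
-- applied to the prime p 1 = 1 + A·a·w gives A·a ∣ N - 1, which no-divisor refutes.
lemma2 : (a m b s n : ℕ) → 2 ≤ a → 2 ≤ m → 1 ≤ s → 1 ≤ n →
    (p : Fin m → ℕ) →
    ((i j : Fin m) → toℕ i < toℕ j → p i < p j) →
    ((i : Fin m) → Prime (p i)) →
    ((i : Fin m) → ∃[ k ] (1 ≤ k × k ≤ s × p i ≡ a ^ (b + k) * n + 1)) →
    ¬ Carmichael (prodFin m p)
lemma2 a m b s n 2≤a (s≤s (s≤s z≤n)) _ 1≤n p increasing prime shape (_ , carmichael) =
  no-divisor t 2≤a A≢0 (subst (λ N → A * a ∣ pred N) N≡ Aa∣N-1)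
  where
  1≤a : 1 ≤ a
  1≤a = ℕP.<⇒≤ 2≤a
  e : Fin m → ℕ
  e i = b + proj₁ (shape i)
  p≡ : ∀ i → p i ≡ a ^ e i * n + 1
  p≡ i = proj₂ (proj₂ (proj₂ (shape i)))

  A : ℕ
  A = a ^ e 0F * n
  A≢0 : NonZero A
  A≢0 = ℕP.m*n≢0 (a ^ e 0F) n ⦃ ℕP.m^n≢0 a (e 0F) ⦃ >-nonZero 1≤a ⦄ ⦄ ⦃ >-nonZero 1≤n ⦄

  later≡1 : ∀ i → p (1+ i) ≡1[mod A * a ]
  later≡1 i = subst (_≡1[mod A * a ]) (sym (p≡ (1+ i)))
    (≡1-mod-higher a n {e 0F} {e (1+ i)} (exponent-mono 1≤a
      (subst₂ _<_ (p≡ 0F) (p≡ (1+ i)) (increasing 0F (1+ i) (s≤s z≤n)))))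

  rest≡1 : prodFin _ (λ i → p (1+ i)) ≡1[mod A * a ]
  rest≡1 = prodFin-≡1 _ (λ i → p (1+ i)) (A * a) later≡1
  t : ℕ
  t = proj₁ rest≡1
  N≡ : prodFin m p ≡ (A + 1) * (1 + A * a * t)
  N≡ = cong₂ _*_ (p≡ 0F) (proj₂ rest≡1)

  w : ℕ
  w = proj₁ (later≡1 0F)
  p₁≡ : p (1+ 0F) ≡ 1 + A * a * w
  p₁≡ = proj₂ (later≡1 0F)
  Aa∣N-1 : A * a ∣ pred (prodFin m p)
  Aa∣N-1 = ∣-trans (m∣m*n w)
    (korselt (subst Prime p₁≡ (prime (1+ 0F))) carmichael
      (subst (_∣ prodFin m p) p₁≡ (factor∣prodFin m p (1+ 0F))))
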